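{- Let $M$ be an $r\times s$ 0-1 matrix with $al(M)\le k$ and $|C(M)|\le l$, and let $a$ be the number of column indices $j$ with $1\le j<s$ such that the $j$-th column of $M$ differs from the $(j+1)$-th column. Then $a\le (k-1)(2l+1)$.
   Context: Each row and each column of a 0-1 matrix splits into maximal intervals of consecutive equal entries; $al(M)$ is the maximum number of such intervals in a single row or column, over all rows and columns of $M$. For an $r\times s$ matrix $M$ and $j\in[s]$, $C(M,j)=\{a\in[r-1]:\ M(a,j)\ne M(a+1,j)\}$, and $C(M)=\bigcup_{j=1}^sC(M,j)$. -}

module Defs where

open import Data.Nat using (ℕ; zero; suc; _+_; _⊔_)
open import Data.Bool using (Bool)
import Data.Bool.Properties as BoolP
open import Data.Fin using (Fin)
open import Data.List using (List; []; _∷_; map; foldr)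
open import Data.Vec using (Vec; tabulate)
import Data.Vec.Properties as VecP
open import Relation.Nullary using (yes; no)
open import Relation.Binary using (DecidableEquality)

-- An r × s 0-1 matrix: M i j is the entry in row i, column j (0 ↔ false, 1 ↔ true).
Matrix : ℕ → ℕ → Set
Matrix r s = Fin r → Fin s → Bool

changesFrom : {A : Set} → DecidableEquality A → A → List A → ℕ
changesFrom _≟_ x []       = 0
changesFrom _≟_ x (y ∷ xs) with x ≟ y
... | yes _ = changesFrom _≟_ y xs
... | no  _ = suc (changesFrom _≟_ y xs)

changes : {A : Set} → DecidableEquality A → List A → ℕ
changes _≟_ []       = 0
changes _≟_ (x ∷ xs) = changesFrom _≟_ x xs

intervals : List Bool → ℕ
intervals []           = 0
intervals (x ∷ xs)     = suc (changes BoolP._≟_ (x ∷ xs))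

allFinL : (n : ℕ) → List (Fin n)
allFinL n = Data.List.tabulate {n = n} (λ i → i)

rowL : {r s : ℕ} → Matrix r s → Fin r → List Bool
rowL {s = s} M i = map (M i) (allFinL s)

colL : {r s : ℕ} → Matrix r s → Fin s → List Bool
colL {r = r} M j = map (λ i → M i j) (allFinL r)

rowV : {r s : ℕ} → Matrix r s → Fin r → Vec Bool s
rowV M i = tabulate (M i)

colV : {r s : ℕ} → Matrix r s → Fin s → Vec Bool r
colV M j = tabulate (λ i → M i j)

maxL : List ℕ → ℕ
maxL = foldr _⊔_ 0

al : {r s : ℕ} → Matrix r s → ℕ
al {r} {s} M = maxL (map (λ i → intervals (rowL M i)) (allFinL r))
             ⊔ maxL (map (λ j → intervals (colL M j)) (allFinL s))

-- |C(M)|: number of a ∈ [r-1] such that M(a,j) ≠ M(a+1,j) for some column j,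
-- i.e. the number of a such that row a and row a+1 differ.
|C| : {r s : ℕ} → Matrix r s → ℕ
|C| {r} M = changes (VecP.≡-dec BoolP._≟_) (map (rowV M) (allFinL r))

colChanges : {r s : ℕ} → Matrix r s → ℕ
colChanges {s = s} M = changes (VecP.≡-dec BoolP._≟_) (map (colV M) (allFinL s))

{-# OPTIONS --safe #-}
-- The rows of M fall into at most |C(M)| + 1 maximal blocks of equal consecutive rows, and
-- columns j and j+1 differ iff they differ in some block representative.  So every column
-- change is a change inside one of at most |C(M)| + 1 rows, each of which has at most
-- al(M) - 1 changes; this even gives the sharper bound (k - 1)(l + 1).
module Submission where

open import Defs
open import Data.Nat using (ℕ; _≤_; _*_; _+_; _∸_; zero; suc; z≤n; s≤s)
open import Data.Nat.Properties
open import Data.Bool using (Bool)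
import Data.Bool.Properties as Bool
open import Data.Empty using (⊥-elim)
open import Data.Fin using (Fin; zero; suc)
open import Data.List using (List; []; _∷_; tabulate)
open import Data.List.Membership.Propositional using (_∈_)
open import Data.List.Membership.Propositional.Properties using (∈-map⁺; ∈-allFin)
open import Data.List.Properties using (map-tabulate)
open import Data.List.Relation.Unary.Any using (here; there)
open import Data.Product using (_,_; uncurry)
import Data.Product.Properties as Product
open import Data.Vec using (Vec; _∷_; lookup)
import Data.Vec as Vec
import Data.Vec.Properties as Vecₚ
open import Data.Vec.Functional using (head; tail)
open import Function using (_∘_)
open import Relation.Binary using (DecidableEquality)
open import Relation.Binary.PropositionalEquality
open import Relation.Nullary using (¬_; Dec; yes; no)

runs : {A : Set} → DecidableEquality A → List A → ℕ
runs _≟_ []       = 0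
runs _≟_ (x ∷ xs) = suc (changesFrom _≟_ x xs)

module _ {A : Set} (_≟_ : DecidableEquality A) where

  changesFrom-tail-≤ : ∀ {x y ys} → changesFrom _≟_ y ys ≤ changesFrom _≟_ x (y ∷ ys)
  changesFrom-tail-≤ {x} {y} with x ≟ y
  ... | yes _ = ≤-refl
  ... | no  _ = n≤1+n _

  changesFrom-∷-≡ : ∀ {x y ys} → x ≡ y → changesFrom _≟_ x (y ∷ ys) ≡ changesFrom _≟_ y ys
  changesFrom-∷-≡ {x} {y} x≡y with x ≟ y
  ... | yes _   = refl
  ... | no  x≢y = ⊥-elim (x≢y x≡y)

  changesFrom-∷-≢ : ∀ {x y ys} → ¬ x ≡ y → changesFrom _≟_ x (y ∷ ys) ≡ suc (changesFrom _≟_ y ys)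
  changesFrom-∷-≢ {x} {y} x≢y with x ≟ y
  ... | yes x≡y = ⊥-elim (x≢y x≡y)
  ... | no  _   = refl

  runs-≤-suc-changes : ∀ xs → runs _≟_ xs ≤ suc (changes _≟_ xs)
  runs-≤-suc-changes []      = z≤n
  runs-≤-suc-changes (_ ∷ _) = ≤-refl

  changes-tabulate-const : ∀ {n} (f : Fin n → A) → (∀ i j → f i ≡ f j) →
                           changes _≟_ (tabulate f) ≡ 0
  changes-tabulate-const {zero}        f _     = refl
  changes-tabulate-const {suc zero}    f _     = refl
  changes-tabulate-const {suc (suc n)} f const = begin
    changes _≟_ (tabulate f)         ≡⟨ changesFrom-∷-≡ (const zero (suc zero)) ⟩
    changes _≟_ (tabulate (f ∘ suc)) ≡⟨ changes-tabulate-const (f ∘ suc) (λ i j → const (suc i) (suc j)) ⟩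
    0                                ∎
    where open ≡-Reasoning

module _ {A B : Set} (_≟ᴬ_ : DecidableEquality A) (_≟ᴮ_ : DecidableEquality B) where

  changes-tabulate-mono : ∀ {n} (f : Fin n → A) (g : Fin n → B) →
                          (∀ i j → g i ≡ g j → f i ≡ f j) →
                          changes _≟ᴬ_ (tabulate f) ≤ changes _≟ᴮ_ (tabulate g)
  changes-tabulate-mono {zero}        f g _ = z≤n
  changes-tabulate-mono {suc zero}    f g _ = z≤n
  changes-tabulate-mono {suc (suc n)} f g g≡⇒f≡
    with ih ← changes-tabulate-mono (f ∘ suc) (g ∘ suc) (λ i j → g≡⇒f≡ (suc i) (suc j))
    with f zero ≟ᴬ f (suc zero)
  ... | yes _ = ≤-trans ih (changesFrom-tail-≤ _≟ᴮ_)
  ... | no f₀≢f₁ with g zero ≟ᴮ g (suc zero)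
  ...   | yes g₀≡g₁ = ⊥-elim (f₀≢f₁ (g≡⇒f≡ zero (suc zero) g₀≡g₁))
  ...   | no  _     = s≤s ih

  changes-tabulate-pair : ∀ {n} (f : Fin n → A) (g : Fin n → B) →
                          changes (Product.≡-dec _≟ᴬ_ _≟ᴮ_) (tabulate (λ i → f i , g i))
                            ≤ changes _≟ᴬ_ (tabulate f) + changes _≟ᴮ_ (tabulate g)
  changes-tabulate-pair {zero}        f g = z≤n
  changes-tabulate-pair {suc zero}    f g = z≤n
  changes-tabulate-pair {suc (suc n)} f g
    with ih ← changes-tabulate-pair (f ∘ suc) (g ∘ suc)
    with Product.≡-dec _≟ᴬ_ _≟ᴮ_ (f zero , g zero) (f (suc zero) , g (suc zero))
  ... | yes _ = ≤-trans ih (+-mono-≤ (changesFrom-tail-≤ _≟ᴬ_) (changesFrom-tail-≤ _≟ᴮ_))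
  ... | no fg₀≢fg₁ with f zero ≟ᴬ f (suc zero)
  ...   | no _ = s≤s (≤-trans ih (+-monoʳ-≤ _ (changesFrom-tail-≤ _≟ᴮ_)))
  ...   | yes f₀≡f₁ with g zero ≟ᴮ g (suc zero)
  ...     | no  _     = ≤-trans (s≤s ih) (≤-reflexive (sym (+-suc _ _)))
  ...     | yes g₀≡g₁ = ⊥-elim (fg₀≢fg₁ (cong₂ _,_ f₀≡f₁ g₀≡g₁))

tabulate-injective : ∀ {A : Set} {n} {f g : Fin n → A} → Vec.tabulate f ≡ Vec.tabulate g → ∀ i → f i ≡ g i
tabulate-injective {f = f} {g} f≡g i = begin
  f i                       ≡⟨ Vecₚ.lookup∘tabulate f i ⟨
  lookup (Vec.tabulate f) i ≡⟨ cong (λ v → lookup v i) f≡g ⟩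
  lookup (Vec.tabulate g) i ≡⟨ Vecₚ.lookup∘tabulate g i ⟩
  g i                       ∎
  where open ≡-Reasoning

≤-maxL : ∀ {x xs} → x ∈ xs → x ≤ maxL xs
≤-maxL (here refl)                = m≤m⊔n _ _
≤-maxL {xs = y ∷ _} (there x∈xs) = ≤-trans (≤-maxL x∈xs) (m≤n⊔m y _)

changes≡intervals∸1 : ∀ xs → changes Bool._≟_ xs ≡ intervals xs ∸ 1
changes≡intervals∸1 []      = refl
changes≡intervals∸1 (_ ∷ _) = refl

_≟ᵛ_ : ∀ {n} → DecidableEquality (Vec Bool n)
_≟ᵛ_ = Vecₚ.≡-dec Bool._≟_

rowChanges : ∀ {s} → (Fin s → Bool) → ℕ
rowChanges row = changes Bool._≟_ (tabulate row)

columnChanges : ∀ {r s} → Matrix r s → ℕ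
columnChanges M = changes _≟ᵛ_ (tabulate (colV M))

rowRuns : ∀ {r s} → Matrix r s → ℕ
rowRuns M = runs _≟ᵛ_ (tabulate (rowV M))

module _ {s : ℕ} where

  columnChanges-noRows : (M : Matrix 0 s) → columnChanges M ≡ 0
  columnChanges-noRows M = changes-tabulate-const _≟ᵛ_ (colV M) (λ _ _ → refl)

  columnChanges-≤-head+tail : ∀ {r} (M : Matrix (suc r) s) →
                              columnChanges M ≤ rowChanges (head M) + columnChanges (tail M)
  columnChanges-≤-head+tail M = ≤-trans
    (changes-tabulate-mono _≟ᵛ_ (Product.≡-dec Bool._≟_ _≟ᵛ_) (colV M) (λ j → M zero j , colV (tail M) j)
      (λ _ _ → cong (uncurry _∷_)))
    (changes-tabulate-pair Bool._≟_ _≟ᵛ_ (head M) (colV (tail M)))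

  columnChanges-≤-tail : ∀ {r} (M : Matrix (suc (suc r)) s) → (∀ j → M zero j ≡ M (suc zero) j) →
                         columnChanges M ≤ columnChanges (tail M)
  columnChanges-≤-tail M M₀≗M₁ = changes-tabulate-mono _≟ᵛ_ _≟ᵛ_ (colV M) (colV (tail M))
    (λ i j col≡ → cong₂ _∷_ (trans (M₀≗M₁ i) (trans (cong Vec.head col≡) (sym (M₀≗M₁ j)))) col≡)

  module _ (K : ℕ) where

    columnChanges-≤-suc-tail : ∀ {r} (M : Matrix (suc r) s) → (∀ i → rowChanges (M i) ≤ K) →
                               columnChanges (tail M) ≤ K * rowRuns (tail M) →
                               columnChanges M ≤ K * suc (rowRuns (tail M))
    columnChanges-≤-suc-tail M bounded ih = begin
      columnChanges M                              ≤⟨ columnChanges-≤-head+tail M ⟩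
      rowChanges (head M) + columnChanges (tail M) ≤⟨ +-mono-≤ (bounded zero) ih ⟩
      K + K * rowRuns (tail M)                     ≡⟨ *-suc K _ ⟨
      K * suc (rowRuns (tail M))                   ∎
      where open ≤-Reasoning

    columnChanges-≤-*-rowRuns-step : ∀ {r} (M : Matrix (suc (suc r)) s) → (∀ i → rowChanges (M i) ≤ K) →
                                     columnChanges (tail M) ≤ K * rowRuns (tail M) →
                                     Dec (rowV M zero ≡ rowV M (suc zero)) →
                                     columnChanges M ≤ K * rowRuns M
    columnChanges-≤-*-rowRuns-step M _ ih (yes row₀≡row₁) = begin
      columnChanges M        ≤⟨ columnChanges-≤-tail M (tabulate-injective row₀≡row₁) ⟩
      columnChanges (tail M) ≤⟨ ih ⟩
      K * rowRuns (tail M)   ≡⟨ cong (λ n → K * suc n) (changesFrom-∷-≡ _≟ᵛ_ row₀≡row₁) ⟨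
      K * rowRuns M          ∎
      where open ≤-Reasoning
    columnChanges-≤-*-rowRuns-step M bounded ih (no row₀≢row₁) = begin
      columnChanges M            ≤⟨ columnChanges-≤-suc-tail M bounded ih ⟩
      K * suc (rowRuns (tail M)) ≡⟨ cong (λ n → K * suc n) (changesFrom-∷-≢ _≟ᵛ_ row₀≢row₁) ⟨
      K * rowRuns M              ∎
      where open ≤-Reasoning

    columnChanges-≤-*-rowRuns : ∀ {r} (M : Matrix r s) → (∀ i → rowChanges (M i) ≤ K) →
                                columnChanges M ≤ K * rowRuns M
    columnChanges-≤-*-rowRuns {zero} M _ = ≤-trans (≤-reflexive (columnChanges-noRows M)) z≤n
    columnChanges-≤-*-rowRuns {suc zero} M bounded =
      columnChanges-≤-suc-tail M bounded (columnChanges-≤-*-rowRuns (tail M) (bounded ∘ suc))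
    columnChanges-≤-*-rowRuns {suc (suc r)} M bounded =
      columnChanges-≤-*-rowRuns-step M bounded (columnChanges-≤-*-rowRuns (tail M) (bounded ∘ suc))
        (rowV M zero ≟ᵛ rowV M (suc zero))

rowChanges-≤-al∸1 : ∀ {r s} (M : Matrix r s) i → rowChanges (M i) ≤ al M ∸ 1
rowChanges-≤-al∸1 {r} M i = begin
  rowChanges (M i)             ≡⟨ cong (changes Bool._≟_) (map-tabulate (λ j → j) (M i)) ⟨
  changes Bool._≟_ (rowL M i)  ≡⟨ changes≡intervals∸1 (rowL M i) ⟩
  intervals (rowL M i) ∸ 1     ≤⟨ ∸-monoˡ-≤ 1 (≤-trans (≤-maxL (∈-map⁺ rowIntervals (∈-allFin i))) (m≤m⊔n _ _)) ⟩
  al M ∸ 1                     ∎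
  where
  open ≤-Reasoning
  rowIntervals : Fin r → ℕ
  rowIntervals i = intervals (rowL M i)

lemma3p12 : (r s k l : ℕ) (M : Matrix r s) → al M ≤ k → |C| M ≤ l →
    colChanges M ≤ (k ∸ 1) * (2 * l + 1)
lemma3p12 r s k l M alM≤k |C|≤l = begin
  colChanges M            ≡⟨ cong (changes _≟ᵛ_) (map-tabulate (λ j → j) (colV M)) ⟩
  columnChanges M         ≤⟨ columnChanges-≤-*-rowRuns (k ∸ 1) M rowsBounded ⟩
  (k ∸ 1) * rowRuns M     ≤⟨ *-monoʳ-≤ (k ∸ 1) rowRuns≤2l+1 ⟩
  (k ∸ 1) * (2 * l + 1)   ∎
  where
  open ≤-Reasoning
  rowsBounded : ∀ i → rowChanges (M i) ≤ k ∸ 1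
  rowsBounded i = ≤-trans (rowChanges-≤-al∸1 M i) (∸-monoˡ-≤ 1 alM≤k)
  rowRuns≤2l+1 : rowRuns M ≤ 2 * l + 1
  rowRuns≤2l+1 = begin
    rowRuns M                              ≤⟨ runs-≤-suc-changes _≟ᵛ_ (tabulate (rowV M)) ⟩
    suc (changes _≟ᵛ_ (tabulate (rowV M))) ≡⟨ cong (suc ∘ changes _≟ᵛ_) (map-tabulate (λ i → i) (rowV M)) ⟨
    suc (|C| M)                            ≤⟨ s≤s (≤-trans |C|≤l (m≤n*m l 2)) ⟩
    suc (2 * l)                            ≡⟨ +-comm 1 (2 * l) ⟩
    2 * l + 1                              ∎
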